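{- Let $a,b,p,q$ be complex numbers with $p\neq 0$, $q\neq 0$, and let $(W_j)$, $(U_j)$ be as defined in the context. If $n$ is a non-negative integer and $r$, $s$ and $t$ are any integers, then \[ \sum_{k = 0}^n ( - 1)^k \binom nk^3 U_{r + s}^{n - k} U_s^k W_{t + rk} = \sum_{k = 0}^n ( - 1)^k \binom{n + k}{2k}\binom{2k}{k}\binom{n - k}{k} q^{s(n - 2k)} U_{r + s}^k U_s^k U_r^{n - 2k} W_{t + rk - s(n - 2k)}. \]
   Context: The Horadam sequence $W_j=W_j(a,b;p,q)$ is defined by $W_0=a$, $W_1=b$, $W_j=pW_{j-1}-qW_{j-2}$ for $j\ge 2$, and extended to negative indices by $W_{ -j}=\frac{1}{q}(pW_{ -j+1}-W_{ -j+2})$. The Lucas sequence of the first kind is $U_j=W_j(0,1;p,q)$. Binomial coefficients $\binom{N}{k}$ with $k>N\ge 0$ are $0$ (so terms with $2k>n$ vanish). -}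

module Defs where

open import Level using (Level)
open import Data.Nat as ℕ using (ℕ; zero; suc)
open import Data.Integer as ℤ using (ℤ; +_; -[1+_])
open import Data.Product using (Σ)
open import Relation.Nullary using (¬_)
open import Algebra.Bundles using (CommutativeRing)

record IsField {c ℓ : Level} (R : CommutativeRing c ℓ) : Set (c Level.⊔ ℓ) where
  open CommutativeRing R hiding (zero)
  field
    1≉0 : ¬ (1# ≈ 0#)
    inverse : (x : Carrier) → ¬ (x ≈ 0#) → Σ Carrier (λ y → x * y ≈ 1#)

module RingDefs {c ℓ : Level} (R : CommutativeRing c ℓ) where
  open CommutativeRing R hiding (zero)

  pow : Carrier → ℕ → Carrier
  pow x zero = 1#
  pow x (suc n) = x * pow x n

  zpow : Carrier → Carrier → ℤ → Carrier
  zpow x xi (+ n) = pow x n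
  zpow x xi -[1+ n ] = pow xi (suc n)

  fromℕ : ℕ → Carrier
  fromℕ zero = 0#
  fromℕ (suc n) = 1# + fromℕ n

  sumTo : ℕ → (ℕ → Carrier) → Carrier
  sumTo zero f = f zero
  sumTo (suc n) f = sumTo n f + f (suc n)

  -- Horadam sequence W_j(a,b;p,q), qi being the inverse of q
  module Horadam (a b p q qi : Carrier) where
    Wpos : ℕ → Carrier
    Wpos zero = a
    Wpos (suc zero) = b
    Wpos (suc (suc j)) = p * Wpos (suc j) - q * Wpos j

    Wneg : ℕ → Carrier
    Wneg zero = a
    Wneg (suc zero) = qi * (p * a - b)
    Wneg (suc (suc j)) = qi * (p * Wneg (suc j) - Wneg j)

    W : ℤ → Carrier
    W (+ n) = Wpos n
    W -[1+ n ] = Wneg (suc n)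

-- Two applications of Vandermonde's convolution give ∑_k C(m,k) C(j,k) C(m+j+k,k) = C(m+j,m)^2,
-- hence C(n,m)^3 = ∑_k C(n,m) C(m,k) C(n-m,k) C(n+k,k), and at m = k + l trinomial revision rewrites
-- this coefficient as C(n+k,2k) C(2k,k) C(n-k,k) C(n-2k,l). After exchanging the sums, the k-th column
-- is (-1)^k C(n+k,2k) C(2k,k) C(n-k,k) U_{r+s}^k U_s^k ∑_l (-1)^l C(e,l) U_{r+s}^{e-l} U_s^l W_{T+rl}
-- with e = n - 2k and T = t + rk, and the inner sum is q^{se} U_r^e W_{T-se}: induction on e, iterating
-- the shift identity q^s U_r W_{T-s} = U_{r+s} W_T - U_s W_{T+r}. That identity holds because both sides
-- satisfy the Horadam recurrence in r and agree at r = 0 and r = 1, the latter case being proved the same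
-- way as a recurrence in s. Columns with 2k > n vanish on both sides through the factor C(n-k,k).

{-# OPTIONS --safe #-}
module Submission where

open import Level using (Level)
open import Algebra.Bundles using (CommutativeSemiring; CommutativeRing)
open import Data.Nat as ℕ using (ℕ; zero; suc; _∸_; _≤_; _<_; z≤n; s≤s)
import Data.Nat.Properties as ℕ
open import Data.Nat.Combinatorics using (_C_; k>n⇒nCk≡0; nCk+nC[k+1]≡[n+1]C[k+1])
import Data.Nat.Tactic.RingSolver as ℕ-Solver
open import Data.Integer as ℤ using (ℤ; +_; -[1+_]; _⊖_; _◃_; sign; ∣_∣)
import Data.Integer.Properties as ℤ
import Data.Integer.Tactic.RingSolver as ℤ-Solver
import Data.Sign as Sign
open Sign using (Sign)
open import Data.Maybe using (Maybe; just; nothing)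
open import Data.Product using (proj₁; proj₂)
open import Relation.Binary.PropositionalEquality as ≡ using (_≡_)
open import Relation.Nullary using (¬_; yes; no)
import Algebra.Solver.Ring
open import Algebra.Solver.Ring.AlmostCommutativeRing using (_-Raw-AlmostCommutative⟶_; fromCommutativeRing)
import Algebra.Properties.Semiring.Mult.TCOptimised as SemiringMultiplication
import Algebra.Properties.Ring as RingProperties
import Algebra.Properties.CommutativeSemigroup as CommutativeSemigroupProperties
open import Defs

module FiniteSum {c ℓ : Level} (S : CommutativeSemiring c ℓ) where
  open CommutativeSemiring S
  open CommutativeSemigroupProperties +-commutativeSemigroup using () renaming (x∙yz≈y∙xz to x+[y+z]≈y+[x+z])
  open import Relation.Binary.Reasoning.Setoid setoid

  ∑≤ : ℕ → (ℕ → Carrier) → Carrier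
  ∑≤ zero    f = f 0
  ∑≤ (suc n) f = ∑≤ n f + f (suc n)

  infixl 10 ∑≤
  syntax ∑≤ n (λ i → e) = ∑[ i ≤ n ] e

  ∑≤-cong : ∀ n {f g : ℕ → Carrier} → (∀ i → i ≤ n → f i ≈ g i) → ∑≤ n f ≈ ∑≤ n g
  ∑≤-cong zero    f≈g = f≈g 0 z≤n
  ∑≤-cong (suc n) f≈g = +-cong (∑≤-cong n λ i i≤n → f≈g i (ℕ.m≤n⇒m≤1+n i≤n)) (f≈g (suc n) ℕ.≤-refl)

  ∑≤-distrib-+ : ∀ n (f g : ℕ → Carrier) → ∑[ i ≤ n ] (f i + g i) ≈ ∑≤ n f + ∑≤ n g
  ∑≤-distrib-+ zero    f g = refl
  ∑≤-distrib-+ (suc n) f g = begin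
    ∑[ i ≤ n ] (f i + g i) + (f (suc n) + g (suc n)) ≈⟨ +-congʳ (∑≤-distrib-+ n f g) ⟩
    (∑≤ n f + ∑≤ n g) + (f (suc n) + g (suc n))     ≈⟨ +-assoc _ _ _ ⟩
    ∑≤ n f + (∑≤ n g + (f (suc n) + g (suc n)))     ≈⟨ +-congˡ (x+[y+z]≈y+[x+z] _ _ _) ⟩
    ∑≤ n f + (f (suc n) + (∑≤ n g + g (suc n)))     ≈⟨ +-assoc _ _ _ ⟨
    ∑≤ (suc n) f + ∑≤ (suc n) g                     ∎

  *-distribˡ-∑≤ : ∀ n x (f : ℕ → Carrier) → x * ∑≤ n f ≈ ∑[ i ≤ n ] (x * f i)
  *-distribˡ-∑≤ zero    x f = refl
  *-distribˡ-∑≤ (suc n) x f = trans (distribˡ x _ _) (+-congʳ (*-distribˡ-∑≤ n x f))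

  *-distribʳ-∑≤ : ∀ n x (f : ℕ → Carrier) → ∑≤ n f * x ≈ ∑[ i ≤ n ] (f i * x)
  *-distribʳ-∑≤ n x f = trans (*-comm _ x) (trans (*-distribˡ-∑≤ n x f) (∑≤-cong n λ i _ → *-comm x (f i)))

  ∑≤-comm : ∀ m n (f : ℕ → ℕ → Carrier) → ∑[ i ≤ m ] ∑[ j ≤ n ] f i j ≈ ∑[ j ≤ n ] ∑[ i ≤ m ] f i j
  ∑≤-comm zero    n f = refl
  ∑≤-comm (suc m) n f = trans (+-congʳ (∑≤-comm m n f)) (sym (∑≤-distrib-+ n _ _))

  ∑≤-suc : ∀ n (f : ℕ → Carrier) → ∑≤ (suc n) f ≈ f 0 + ∑[ i ≤ n ] f (suc i)
  ∑≤-suc zero    f = refl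
  ∑≤-suc (suc n) f = trans (+-congʳ (∑≤-suc n f)) (+-assoc _ _ _)

  ∑≤-zero : ∀ n {f : ℕ → Carrier} → (∀ i → i ≤ n → f i ≈ 0#) → ∑≤ n f ≈ 0#
  ∑≤-zero zero    f≈0 = f≈0 0 z≤n
  ∑≤-zero (suc n) f≈0 = trans (+-cong (∑≤-zero n λ i i≤n → f≈0 i (ℕ.m≤n⇒m≤1+n i≤n)) (f≈0 (suc n) ℕ.≤-refl)) (+-identityˡ 0#)

  ∑≤-truncate : ∀ {m n} (f : ℕ → Carrier) → m ≤ n → (∀ i → m < i → f i ≈ 0#) → ∑≤ n f ≈ ∑≤ m f
  ∑≤-truncate {m} f m≤n f≈0 = go (ℕ.≤⇒≤′ m≤n)
    where
    go : ∀ {n} → m ℕ.≤′ n → ∑≤ n f ≈ ∑≤ m f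
    go ℕ.≤′-refl            = refl
    go (ℕ.≤′-step {n} m≤′n) = trans (+-cong (go m≤′n) (f≈0 (suc n) (s≤s (ℕ.≤′⇒≤ m≤′n)))) (+-identityʳ _)

  ∑≤-shift : ∀ k n (f : ℕ → Carrier) → (∀ i → i < k → f i ≈ 0#) → ∑≤ (k ℕ.+ n) f ≈ ∑[ l ≤ n ] f (k ℕ.+ l)
  ∑≤-shift zero    n f f≈0 = refl
  ∑≤-shift (suc k) n f f≈0 = begin
    ∑≤ (suc k ℕ.+ n) f                     ≈⟨ ∑≤-suc (k ℕ.+ n) f ⟩
    f 0 + ∑[ i ≤ k ℕ.+ n ] f (suc i)       ≈⟨ +-cong (f≈0 0 (s≤s z≤n)) (∑≤-shift k n (λ i → f (suc i)) λ i i<k → f≈0 (suc i) (s≤s i<k)) ⟩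
    0# + ∑[ l ≤ n ] f (suc k ℕ.+ l)        ≈⟨ +-identityˡ _ ⟩
    ∑[ l ≤ n ] f (suc k ℕ.+ l)             ∎

module Binomial where
  open import Data.Nat
  open import Data.Nat.Properties
  open import Data.Nat.Combinatorics
  open import Data.Nat.DivMod using (m/n*n≡m)
  open ℕ-Solver using (solve-∀)
  open import Relation.Binary.PropositionalEquality
  open FiniteSum +-*-commutativeSemiring
  open ≡-Reasoning

  nCk*[k!*[n∸k]!]≡n! : ∀ {n k} → k ≤ n → (n C k) * (k ! * (n ∸ k) !) ≡ n !
  nCk*[k!*[n∸k]!]≡n! {n} {k} k≤n = begin
    (n C k) * (k ! * (n ∸ k) !)                  ≡⟨ cong (_* (k ! * (n ∸ k) !)) (nCk≡n!/k![n-k]! k≤n) ⟩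
    n ! / (k ! * (n ∸ k) !) * (k ! * (n ∸ k) !)  ≡⟨ m/n*n≡m (k![n∸k]!∣n! k≤n) ⟩
    n !                                          ∎
    where instance _ = k !* (n ∸ k) !≢0

  nCk*[n∸k]Cj≡nC[k+j]*[k+j]Ck : ∀ n k j → (n C k) * ((n ∸ k) C j) ≡ (n C (k + j)) * ((k + j) C k)
  nCk*[n∸k]Cj≡nC[k+j]*[k+j]Ck n k j with k + j ≤? n
  ... | yes k+j≤n = *-cancelʳ-≡ _ _ (k ! * (j ! * (n ∸ (k + j)) !)) (trans lhs≡n! (sym rhs≡n!))
    where
    instance _ = m*n≢0 (k !) (j ! * (n ∸ (k + j)) !) {{k !≢0}} {{j !* (n ∸ (k + j)) !≢0}}
    k≤n : k ≤ n
    k≤n = ≤-trans (m≤m+n k j) k+j≤n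
    j≤n∸k : j ≤ n ∸ k
    j≤n∸k = subst (_≤ n ∸ k) (m+n∸m≡n k j) (∸-monoˡ-≤ k k+j≤n)
    lhs≡n! : (n C k) * ((n ∸ k) C j) * (k ! * (j ! * (n ∸ (k + j)) !)) ≡ n !
    lhs≡n! = begin
      (n C k) * ((n ∸ k) C j) * (k ! * (j ! * (n ∸ (k + j)) !))
        ≡⟨ cong (λ m → (n C k) * ((n ∸ k) C j) * (k ! * (j ! * m !))) (∸-+-assoc n k j) ⟨
      (n C k) * ((n ∸ k) C j) * (k ! * (j ! * (n ∸ k ∸ j) !))
        ≡⟨ reassoc (n C k) ((n ∸ k) C j) (k !) (j !) ((n ∸ k ∸ j) !) ⟩
      (n C k) * (k ! * (((n ∸ k) C j) * (j ! * (n ∸ k ∸ j) !)))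
        ≡⟨ cong (λ m → (n C k) * (k ! * m)) (nCk*[k!*[n∸k]!]≡n! j≤n∸k) ⟩
      (n C k) * (k ! * (n ∸ k) !)
        ≡⟨ nCk*[k!*[n∸k]!]≡n! k≤n ⟩
      n ! ∎
      where
      reassoc : ∀ a b x y z → a * b * (x * (y * z)) ≡ a * (x * (b * (y * z)))
      reassoc = solve-∀
    rhs≡n! : (n C (k + j)) * ((k + j) C k) * (k ! * (j ! * (n ∸ (k + j)) !)) ≡ n !
    rhs≡n! = begin
      (n C (k + j)) * ((k + j) C k) * (k ! * (j ! * (n ∸ (k + j)) !))
        ≡⟨ reassoc (n C (k + j)) ((k + j) C k) (k !) (j !) ((n ∸ (k + j)) !) ⟩
      (n C (k + j)) * (((k + j) C k) * (k ! * j !) * (n ∸ (k + j)) !)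
        ≡⟨ cong (λ m → (n C (k + j)) * (((k + j) C k) * (k ! * m !) * (n ∸ (k + j)) !)) (m+n∸m≡n k j) ⟨
      (n C (k + j)) * (((k + j) C k) * (k ! * (k + j ∸ k) !) * (n ∸ (k + j)) !)
        ≡⟨ cong (λ m → (n C (k + j)) * (m * (n ∸ (k + j)) !)) (nCk*[k!*[n∸k]!]≡n! (m≤m+n k j)) ⟩
      (n C (k + j)) * ((k + j) ! * (n ∸ (k + j)) !)
        ≡⟨ nCk*[k!*[n∸k]!]≡n! k+j≤n ⟩
      n ! ∎
      where
      reassoc : ∀ a b x y z → a * b * (x * (y * z)) ≡ a * (b * (x * y) * z)
      reassoc = solve-∀
  ... | no k+j≰n = begin
    (n C k) * ((n ∸ k) C j)         ≡⟨ lhs≡0 ⟩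
    0                               ≡⟨ cong (_* ((k + j) C k)) (k>n⇒nCk≡0 (≰⇒> k+j≰n)) ⟨
    (n C (k + j)) * ((k + j) C k)   ∎
    where
    lhs≡0 : (n C k) * ((n ∸ k) C j) ≡ 0
    lhs≡0 with k ≤? n
    ... | no k≰n  = cong (_* ((n ∸ k) C j)) (k>n⇒nCk≡0 (≰⇒> k≰n))
    ... | yes k≤n = trans (cong ((n C k) *_) (k>n⇒nCk≡0 n∸k<j)) (*-zeroʳ (n C k))
      where
      n∸k<j : n ∸ k < j
      n∸k<j = +-cancelˡ-< k (n ∸ k) j (subst (_< k + j) (sym (m+[n∸m]≡n k≤n)) (≰⇒> k+j≰n))

  nCk*[n∸k]Cj≡nCj*[n∸j]Ck : ∀ n k j → (n C k) * ((n ∸ k) C j) ≡ (n C j) * ((n ∸ j) C k)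
  nCk*[n∸k]Cj≡nCj*[n∸j]Ck n k j = begin
    (n C k) * ((n ∸ k) C j)         ≡⟨ nCk*[n∸k]Cj≡nC[k+j]*[k+j]Ck n k j ⟩
    (n C (k + j)) * ((k + j) C k)   ≡⟨ cong₂ (λ m l → (n C m) * l) (+-comm k j) [k+j]Ck≡[j+k]Cj ⟩
    (n C (j + k)) * ((j + k) C j)   ≡⟨ nCk*[n∸k]Cj≡nC[k+j]*[k+j]Ck n j k ⟨
    (n C j) * ((n ∸ j) C k)         ∎
    where
    [k+j]Ck≡[j+k]Cj : (k + j) C k ≡ (j + k) C j
    [k+j]Ck≡[j+k]Cj = begin
      (k + j) C k           ≡⟨ nCk≡nC[n∸k] (m≤m+n k j) ⟩
      (k + j) C (k + j ∸ k) ≡⟨ cong₂ _C_ (+-comm k j) (m+n∸m≡n k j) ⟩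
      (j + k) C j           ∎

  vandermonde : ∀ a b i → ∑[ l ≤ a ] ((a C l) * (b C (i + l))) ≡ (a + b) C (a + i)
  vandermonde zero b i = trans (+-identityʳ _) (cong (b C_) (+-identityʳ i))
  vandermonde (suc a) b i = begin
    ∑[ l ≤ suc a ] ((suc a C l) * (b C (i + l)))
      ≡⟨ ∑≤-suc a _ ⟩
    (a C 0) * (b C (i + 0)) + ∑[ l ≤ a ] ((suc a C suc l) * (b C (i + suc l)))
      ≡⟨ cong (_+_ ((a C 0) * (b C (i + 0)))) (∑≤-cong a λ l _ → pascal l) ⟩
    (a C 0) * (b C (i + 0)) + ∑[ l ≤ a ] ((a C l) * (b C (suc i + l)) + (a C suc l) * (b C (i + suc l)))
      ≡⟨ cong (_+_ ((a C 0) * (b C (i + 0)))) (∑≤-distrib-+ a _ _) ⟩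
    (a C 0) * (b C (i + 0)) + (∑[ l ≤ a ] ((a C l) * (b C (suc i + l))) + ∑[ l ≤ a ] ((a C suc l) * (b C (i + suc l))))
      ≡⟨ x+[y+z]≡y+[x+z] ((a C 0) * (b C (i + 0))) (∑[ l ≤ a ] ((a C l) * (b C (suc i + l)))) _ ⟩
    ∑[ l ≤ a ] ((a C l) * (b C (suc i + l))) + ((a C 0) * (b C (i + 0)) + ∑[ l ≤ a ] ((a C suc l) * (b C (i + suc l))))
      ≡⟨ cong₂ _+_ (sym (vandermonde a b (suc i))) (∑≤-suc a _) ⟨
    (a + b) C (a + suc i) + ∑[ l ≤ suc a ] ((a C l) * (b C (i + l)))
      ≡⟨ cong₂ _+_ (cong ((a + b) C_) (+-suc a i)) (cong (_+_ (∑[ l ≤ a ] ((a C l) * (b C (i + l))))) aCsuca≡0) ⟩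
    (a + b) C suc (a + i) + (∑[ l ≤ a ] ((a C l) * (b C (i + l))) + 0)
      ≡⟨ cong (_+_ ((a + b) C suc (a + i))) (trans (+-identityʳ _) (vandermonde a b i)) ⟩
    (a + b) C suc (a + i) + (a + b) C (a + i)
      ≡⟨ +-comm ((a + b) C suc (a + i)) _ ⟩
    (a + b) C (a + i) + (a + b) C suc (a + i)
      ≡⟨ nCk+nC[k+1]≡[n+1]C[k+1] (a + b) (a + i) ⟩
    suc (a + b) C suc (a + i) ∎
    where
    pascal : ∀ l → (suc a C suc l) * (b C (i + suc l)) ≡ (a C l) * (b C (suc i + l)) + (a C suc l) * (b C (i + suc l))
    pascal l = begin
      (suc a C suc l) * (b C (i + suc l))                           ≡⟨ cong (_* (b C (i + suc l))) (nCk+nC[k+1]≡[n+1]C[k+1] a l) ⟨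
      ((a C l) + (a C suc l)) * (b C (i + suc l))                   ≡⟨ *-distribʳ-+ (b C (i + suc l)) (a C l) (a C suc l) ⟩
      (a C l) * (b C (i + suc l)) + (a C suc l) * (b C (i + suc l)) ≡⟨ cong (λ m → (a C l) * (b C m) + (a C suc l) * (b C (i + suc l))) (+-suc i l) ⟩
      (a C l) * (b C (suc i + l)) + (a C suc l) * (b C (i + suc l)) ∎
    aCsuca≡0 : (a C suc a) * (b C (i + suc a)) ≡ 0
    aCsuca≡0 = cong (_* (b C (i + suc a))) (k>n⇒nCk≡0 (n<1+n a))
    x+[y+z]≡y+[x+z] : ∀ x y z → x + (y + z) ≡ y + (x + z)
    x+[y+z]≡y+[x+z] = solve-∀

  [n+k]Ck≡∑kCi*nCi : ∀ n {k K} → k ≤ K → (n + k) C k ≡ ∑[ i ≤ K ] ((k C i) * (n C i))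
  [n+k]Ck≡∑kCi*nCi n {k} {K} k≤K = begin
    (n + k) C k                       ≡⟨ cong₂ _C_ (+-comm k n) (+-identityʳ k) ⟨
    (k + n) C (k + 0)                 ≡⟨ vandermonde k n 0 ⟨
    ∑[ i ≤ k ] ((k C i) * (n C i))    ≡⟨ ∑≤-truncate _ k≤K (λ i k<i → cong (_* (n C i)) (k>n⇒nCk≡0 k<i)) ⟨
    ∑[ i ≤ K ] ((k C i) * (n C i))    ∎

  ∑jCk*[mCk*kCi]≡mCi*[m∸i+j]C[m∸i+i] : ∀ m j {i K} → m ≤ K → i ≤ K →
    ∑[ k ≤ K ] ((j C k) * ((m C k) * (k C i))) ≡ (m C i) * ((m ∸ i + j) C (m ∸ i + i))
  ∑jCk*[mCk*kCi]≡mCi*[m∸i+j]C[m∸i+i] m j {i} {K} m≤K i≤K = begin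
    ∑[ k ≤ K ] ((j C k) * ((m C k) * (k C i)))
      ≡⟨ cong (λ n → ∑[ k ≤ n ] ((j C k) * ((m C k) * (k C i)))) (m+[n∸m]≡n i≤K) ⟨
    ∑[ k ≤ i + (K ∸ i) ] ((j C k) * ((m C k) * (k C i)))
      ≡⟨ ∑≤-shift i (K ∸ i) _ (λ k k<i → trans (cong (λ x → (j C k) * ((m C k) * x)) (k>n⇒nCk≡0 k<i)) (zeroʳ³ (j C k) (m C k))) ⟩
    ∑[ l ≤ K ∸ i ] ((j C (i + l)) * ((m C (i + l)) * ((i + l) C i)))
      ≡⟨ ∑≤-cong (K ∸ i) (λ l _ → trans (reorder (m C i) ((m ∸ i) C l) (j C (i + l))) (cong ((j C (i + l)) *_) (nCk*[n∸k]Cj≡nC[k+j]*[k+j]Ck m i l))) ⟨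
    ∑[ l ≤ K ∸ i ] ((m C i) * (((m ∸ i) C l) * (j C (i + l))))
      ≡⟨ *-distribˡ-∑≤ (K ∸ i) (m C i) _ ⟨
    (m C i) * ∑[ l ≤ K ∸ i ] (((m ∸ i) C l) * (j C (i + l)))
      ≡⟨ cong ((m C i) *_) (∑≤-truncate _ (∸-monoˡ-≤ i m≤K) λ l m∸i<l → cong (_* (j C (i + l))) (k>n⇒nCk≡0 m∸i<l)) ⟩
    (m C i) * ∑[ l ≤ m ∸ i ] (((m ∸ i) C l) * (j C (i + l)))
      ≡⟨ cong ((m C i) *_) (vandermonde (m ∸ i) j i) ⟩
    (m C i) * ((m ∸ i + j) C (m ∸ i + i)) ∎
    where
    zeroʳ³ : ∀ x y → x * (y * 0) ≡ 0
    zeroʳ³ = solve-∀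
    reorder : ∀ x y z → x * (y * z) ≡ z * (x * y)
    reorder = solve-∀

  ∑mCk*jCk*[m+j+k]Ck≡[m+j]Cm² : ∀ m j →
    ∑[ k ≤ m + j ] ((m C k) * (j C k) * ((m + j + k) C k)) ≡ ((m + j) C m) * ((m + j) C m)
  ∑mCk*jCk*[m+j+k]Ck≡[m+j]Cm² m j = begin
    ∑[ k ≤ N ] ((m C k) * (j C k) * ((N + k) C k))
      ≡⟨ ∑≤-cong N (λ k k≤N → cong ((m C k) * (j C k) *_) ([n+k]Ck≡∑kCi*nCi N k≤N)) ⟩
    ∑[ k ≤ N ] ((m C k) * (j C k) * ∑[ i ≤ N ] ((k C i) * (N C i)))
      ≡⟨ ∑≤-cong N (λ k _ → trans (*-distribˡ-∑≤ N ((m C k) * (j C k)) _) (∑≤-cong N λ i _ → reorder (m C k) (j C k) (k C i) (N C i))) ⟩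
    ∑[ k ≤ N ] ∑[ i ≤ N ] ((N C i) * ((j C k) * ((m C k) * (k C i))))
      ≡⟨ ∑≤-comm N N _ ⟩
    ∑[ i ≤ N ] ∑[ k ≤ N ] ((N C i) * ((j C k) * ((m C k) * (k C i))))
      ≡⟨ ∑≤-cong N (λ i i≤N → trans (sym (*-distribˡ-∑≤ N (N C i) _))
           (cong ((N C i) *_) (∑jCk*[mCk*kCi]≡mCi*[m∸i+j]C[m∸i+i] m j (m≤m+n m j) i≤N))) ⟩
    ∑[ i ≤ N ] ((N C i) * ((m C i) * ((m ∸ i + j) C (m ∸ i + i))))
      ≡⟨ ∑≤-cong N (λ i _ → NCi*[mCi*[m∸i+j]C[m∸i+i]]≡NCm*[mCi*jCi] i) ⟩
    ∑[ i ≤ N ] ((N C m) * ((m C i) * (j C i)))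
      ≡⟨ *-distribˡ-∑≤ N (N C m) _ ⟨
    (N C m) * ∑[ i ≤ N ] ((m C i) * (j C i))
      ≡⟨ cong ((N C m) *_) (∑≤-truncate _ (m≤m+n m j) λ i m<i → cong (_* (j C i)) (k>n⇒nCk≡0 m<i)) ⟩
    (N C m) * ∑[ i ≤ m ] ((m C i) * (j C i))
      ≡⟨ cong ((N C m) *_) (trans (vandermonde m j 0) (cong (N C_) (+-identityʳ m))) ⟩
    (N C m) * (N C m) ∎
    where
    N = m + j
    reorder : ∀ a b c d → a * b * (c * d) ≡ d * (b * (a * c))
    reorder = solve-∀
    NCi*[mCi*[m∸i+j]C[m∸i+i]]≡NCm*[mCi*jCi] : ∀ i → (N C i) * ((m C i) * ((m ∸ i + j) C (m ∸ i + i))) ≡ (N C m) * ((m C i) * (j C i))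
    NCi*[mCi*[m∸i+j]C[m∸i+i]]≡NCm*[mCi*jCi] i with i ≤? m
    ... | no i≰m = trans (cong (λ x → (N C i) * (x * ((m ∸ i + j) C (m ∸ i + i)))) mCi≡0)
                     (trans (*-zeroʳ (N C i)) (sym (trans (cong (λ x → (N C m) * (x * (j C i))) mCi≡0) (*-zeroʳ (N C m)))))
      where
      mCi≡0 : m C i ≡ 0
      mCi≡0 = k>n⇒nCk≡0 (≰⇒> i≰m)
    ... | yes i≤m = begin
      (N C i) * ((m C i) * ((m ∸ i + j) C (m ∸ i + i)))
        ≡⟨ cong₂ (λ x y → (N C i) * ((m C i) * (x C y))) (sym (+-∸-comm j i≤m)) (m∸n+n≡m i≤m) ⟩
      (N C i) * ((m C i) * ((N ∸ i) C m))
        ≡⟨ x*[y*z]≡y*[x*z] (N C i) (m C i) ((N ∸ i) C m) ⟩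
      (m C i) * ((N C i) * ((N ∸ i) C m))
        ≡⟨ cong ((m C i) *_) (nCk*[n∸k]Cj≡nCj*[n∸j]Ck N i m) ⟩
      (m C i) * ((N C m) * ((N ∸ m) C i))
        ≡⟨ cong (λ x → (m C i) * ((N C m) * (x C i))) (m+n∸m≡n m j) ⟩
      (m C i) * ((N C m) * (j C i))
        ≡⟨ x*[y*z]≡y*[x*z] (m C i) (N C m) (j C i) ⟩
      (N C m) * ((m C i) * (j C i)) ∎
      where
      x*[y*z]≡y*[x*z] : ∀ x y z → x * (y * z) ≡ y * (x * z)
      x*[y*z]≡y*[x*z] = solve-∀

  nC[k+l]*[k+l]Ck*[n∸[k+l]]Ck*[n+k]Ck≡[n+k]C2k*2kCk*[n∸k]Ck*[n∸2k]Cl : ∀ n k l →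
    (n C (k + l)) * ((k + l) C k) * ((n ∸ (k + l)) C k) * ((n + k) C k)
      ≡ ((n + k) C (2 * k)) * ((2 * k) C k) * ((n ∸ k) C k) * ((n ∸ 2 * k) C l)
  nC[k+l]*[k+l]Ck*[n∸[k+l]]Ck*[n+k]Ck≡[n+k]C2k*2kCk*[n∸k]Ck*[n∸2k]Cl n k l = begin
    (n C (k + l)) * ((k + l) C k) * ((n ∸ (k + l)) C k) * ((n + k) C k)
      ≡⟨ reorder (n C (k + l)) ((k + l) C k) ((n ∸ (k + l)) C k) ((n + k) C k) ⟩
    ((n + k) C k) * ((n C (k + l)) * ((n ∸ (k + l)) C k)) * ((k + l) C k)
      ≡⟨ cong (λ x → ((n + k) C k) * x * ((k + l) C k)) (nCk*[n∸k]Cj≡nCj*[n∸j]Ck n (k + l) k) ⟩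
    ((n + k) C k) * ((n C k) * ((n ∸ k) C (k + l))) * ((k + l) C k)
      ≡⟨ reassoc ((n + k) C k) (n C k) ((n ∸ k) C (k + l)) ((k + l) C k) ⟩
    ((n + k) C k) * (n C k) * (((n ∸ k) C (k + l)) * ((k + l) C k))
      ≡⟨ cong₂ _*_ (cong (λ x → ((n + k) C k) * (x C k)) (m+n∸n≡m n k)) (nCk*[n∸k]Cj≡nC[k+j]*[k+j]Ck (n ∸ k) k l) ⟨
    ((n + k) C k) * ((n + k ∸ k) C k) * (((n ∸ k) C k) * ((n ∸ k ∸ k) C l))
      ≡⟨ cong₂ _*_ (nCk*[n∸k]Cj≡nC[k+j]*[k+j]Ck (n + k) k k) (cong (λ x → ((n ∸ k) C k) * (x C l)) (∸-+-assoc n k k)) ⟩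
    ((n + k) C (k + k)) * ((k + k) C k) * (((n ∸ k) C k) * ((n ∸ (k + k)) C l))
      ≡⟨ cong (λ x → ((n + k) C x) * (x C k) * (((n ∸ k) C k) * ((n ∸ x) C l))) k+k≡2*k ⟩
    ((n + k) C (2 * k)) * ((2 * k) C k) * (((n ∸ k) C k) * ((n ∸ 2 * k) C l))
      ≡⟨ *-assoc (((n + k) C (2 * k)) * ((2 * k) C k)) ((n ∸ k) C k) ((n ∸ 2 * k) C l) ⟨
    ((n + k) C (2 * k)) * ((2 * k) C k) * ((n ∸ k) C k) * ((n ∸ 2 * k) C l) ∎
    where
    reorder : ∀ a b c d → a * b * c * d ≡ d * (a * c) * b
    reorder = solve-∀
    reassoc : ∀ a b c d → a * (b * c) * d ≡ a * b * (c * d)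
    reassoc = solve-∀
    k+k≡2*k : k + k ≡ 2 * k
    k+k≡2*k = cong (_+_ k) (sym (+-identityʳ k))

  nCm³≡∑nCm*mCk*[n∸m]Ck*[n+k]Ck : ∀ {n m} → m ≤ n →
    (n C m) * ((n C m) * (n C m)) ≡ ∑[ k ≤ n ] ((n C m) * (m C k) * ((n ∸ m) C k) * ((n + k) C k))
  nCm³≡∑nCm*mCk*[n∸m]Ck*[n+k]Ck {n} {m} m≤n = begin
    (n C m) * ((n C m) * (n C m))
      ≡⟨ cong ((n C m) *_) (subst SquareIdentity (m+[n∸m]≡n m≤n) (∑mCk*jCk*[m+j+k]Ck≡[m+j]Cm² m (n ∸ m))) ⟨
    (n C m) * ∑[ k ≤ n ] ((m C k) * ((n ∸ m) C k) * ((n + k) C k))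
      ≡⟨ *-distribˡ-∑≤ n (n C m) _ ⟩
    ∑[ k ≤ n ] ((n C m) * ((m C k) * ((n ∸ m) C k) * ((n + k) C k)))
      ≡⟨ ∑≤-cong n (λ k _ → reassoc (n C m) (m C k) ((n ∸ m) C k) ((n + k) C k)) ⟩
    ∑[ k ≤ n ] ((n C m) * (m C k) * ((n ∸ m) C k) * ((n + k) C k)) ∎
    where
    SquareIdentity : ℕ → Set
    SquareIdentity N = ∑[ k ≤ N ] ((m C k) * ((n ∸ m) C k) * ((N + k) C k)) ≡ (N C m) * (N C m)
    reassoc : ∀ a b c d → a * (b * c * d) ≡ a * b * c * d
    reassoc = solve-∀

module RingLemmas {c ℓ : Level} (R : CommutativeRing c ℓ) where
  open CommutativeRing R hiding (zero)
  open RingDefs R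
  open FiniteSum commutativeSemiring
  open RingProperties ring using (-‿+-comm)
  open import Relation.Binary.Reasoning.Setoid setoid
  private module ℕΣ = FiniteSum ℕ.+-*-commutativeSemiring

  fromℕ-+ : ∀ m n → fromℕ (m ℕ.+ n) ≈ fromℕ m + fromℕ n
  fromℕ-+ zero    n = sym (+-identityˡ _)
  fromℕ-+ (suc m) n = trans (+-congˡ (fromℕ-+ m n)) (sym (+-assoc _ _ _))

  fromℕ-* : ∀ m n → fromℕ (m ℕ.* n) ≈ fromℕ m * fromℕ n
  fromℕ-* zero    n = sym (zeroˡ _)
  fromℕ-* (suc m) n = begin
    fromℕ (n ℕ.+ m ℕ.* n)            ≈⟨ fromℕ-+ n (m ℕ.* n) ⟩
    fromℕ n + fromℕ (m ℕ.* n)        ≈⟨ +-cong (sym (*-identityˡ _)) (fromℕ-* m n) ⟩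
    1# * fromℕ n + fromℕ m * fromℕ n ≈⟨ distribʳ _ _ _ ⟨
    (1# + fromℕ m) * fromℕ n         ∎

  fromℕ-∑≤ : ∀ n (f : ℕ → ℕ) → fromℕ (ℕΣ.∑≤ n f) ≈ ∑[ i ≤ n ] fromℕ (f i)
  fromℕ-∑≤ zero    f = refl
  fromℕ-∑≤ (suc n) f = trans (fromℕ-+ (ℕΣ.∑≤ n f) (f (suc n))) (+-congʳ (fromℕ-∑≤ n f))

  sumTo≡∑≤ : ∀ n f → sumTo n f ≡ ∑≤ n f
  sumTo≡∑≤ zero    f = ≡.refl
  sumTo≡∑≤ (suc n) f = ≡.cong (_+ f (suc n)) (sumTo≡∑≤ n f)

  ∑≤-distrib-- : ∀ n (f g : ℕ → Carrier) → ∑[ i ≤ n ] (f i - g i) ≈ ∑≤ n f - ∑≤ n g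
  ∑≤-distrib-- n f g = trans (∑≤-distrib-+ n f (λ i → - g i)) (+-congˡ (∑≤-neg n))
    where
    ∑≤-neg : ∀ n → ∑[ i ≤ n ] (- g i) ≈ - ∑≤ n g
    ∑≤-neg zero    = refl
    ∑≤-neg (suc n) = trans (+-congʳ (∑≤-neg n)) (-‿+-comm _ _)

  pow-+ : ∀ x m n → pow x (m ℕ.+ n) ≈ pow x m * pow x n
  pow-+ x zero    n = sym (*-identityˡ _)
  pow-+ x (suc m) n = trans (*-congˡ (pow-+ x m n)) (sym (*-assoc x _ _))

-- The ring solver needs a coefficient ring mapping into R. With the TC-optimised n × 1# (where 1 × x is x)
-- the constants con (+ 0) and con (+ 1) evaluate to 0# and 1# definitionally, as the solver's refl requires.
module IntegerCoefficientSolver {c ℓ : Level} (R : CommutativeRing c ℓ) where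
  open CommutativeRing R hiding (zero)
  open SemiringMultiplication semiring using (_×_; 1+×; ×-homo-+; ×1-homo-*)
  open RingProperties ring using (-‿+-comm; -‿involutive; -0#≈0#; -1*x≈-x)
  open CommutativeSemigroupProperties +-commutativeSemigroup using () renaming (interchange to +-interchange)
  open CommutativeSemigroupProperties *-commutativeSemigroup using () renaming (interchange to *-interchange)
  open import Relation.Binary.Reasoning.Setoid setoid

  fromℤ : ℤ → Carrier
  fromℤ (+ n)    = n × 1#
  fromℤ -[1+ n ] = - (suc n × 1#)

  fromℤ-⊖ : ∀ m n → fromℤ (m ⊖ n) ≈ m × 1# - n × 1#
  fromℤ-⊖ m       zero    = trans (sym (+-identityʳ _)) (+-congˡ (sym -0#≈0#))
  fromℤ-⊖ zero    (suc n) = sym (+-identityˡ _)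
  fromℤ-⊖ (suc m) (suc n) = begin
    fromℤ (suc m ⊖ suc n)                  ≡⟨ ≡.cong fromℤ (ℤ.[1+m]⊖[1+n]≡m⊖n m n) ⟩
    fromℤ (m ⊖ n)                          ≈⟨ fromℤ-⊖ m n ⟩
    m × 1# - n × 1#                        ≈⟨ +-identityˡ _ ⟨
    0# + (m × 1# - n × 1#)                 ≈⟨ +-congʳ (-‿inverseʳ 1#) ⟨
    (1# - 1#) + (m × 1# - n × 1#)          ≈⟨ +-interchange 1# (- 1#) (m × 1#) (- (n × 1#)) ⟩
    (1# + m × 1#) + (- 1# + - (n × 1#))    ≈⟨ +-cong (sym (1+× m 1#)) (trans (-‿+-comm 1# (n × 1#)) (-‿cong (sym (1+× n 1#)))) ⟩
    suc m × 1# - suc n × 1#                ∎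

  fromℤ-+ : ∀ i j → fromℤ (i ℤ.+ j) ≈ fromℤ i + fromℤ j
  fromℤ-+ (+ m)    (+ n)    = ×-homo-+ 1# m n
  fromℤ-+ (+ m)    -[1+ n ] = fromℤ-⊖ m (suc n)
  fromℤ-+ -[1+ m ] (+ n)    = trans (fromℤ-⊖ n (suc m)) (+-comm _ _)
  fromℤ-+ -[1+ m ] -[1+ n ] = begin
    - (suc (suc (m ℕ.+ n)) × 1#)           ≡⟨ ≡.cong (λ k → - (suc k × 1#)) (ℕ.+-suc m n) ⟨
    - ((suc m ℕ.+ suc n) × 1#)             ≈⟨ -‿cong (×-homo-+ 1# (suc m) (suc n)) ⟩
    - (suc m × 1# + suc n × 1#)            ≈⟨ -‿+-comm _ _ ⟨
    - (suc m × 1#) + - (suc n × 1#)        ∎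

  fromℤ-neg : ∀ i → fromℤ (ℤ.- i) ≈ - fromℤ i
  fromℤ-neg (+ zero)  = sym -0#≈0#
  fromℤ-neg (+ suc n) = refl
  fromℤ-neg -[1+ n ]  = sym (-‿involutive _)

  σ : Sign → Carrier
  σ Sign.+ = 1#
  σ Sign.- = - 1#

  σ-* : ∀ s t → σ (s Sign.* t) ≈ σ s * σ t
  σ-* Sign.+ t      = sym (*-identityˡ _)
  σ-* Sign.- Sign.+ = sym (*-identityʳ _)
  σ-* Sign.- Sign.- = sym (trans (-1*x≈-x (- 1#)) (-‿involutive 1#))

  fromℤ-◃ : ∀ s n → fromℤ (s ◃ n) ≈ σ s * (n × 1#)
  fromℤ-◃ s      zero    = sym (zeroʳ _)
  fromℤ-◃ Sign.+ (suc n) = sym (*-identityˡ _)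
  fromℤ-◃ Sign.- (suc n) = sym (-1*x≈-x _)

  fromℤ≈σ*∣∣ : ∀ i → fromℤ i ≈ σ (sign i) * (∣ i ∣ × 1#)
  fromℤ≈σ*∣∣ i = trans (reflexive (≡.cong fromℤ (≡.sym (ℤ.◃-inverse i)))) (fromℤ-◃ (sign i) ∣ i ∣)

  fromℤ-* : ∀ i j → fromℤ (i ℤ.* j) ≈ fromℤ i * fromℤ j
  fromℤ-* i j = begin
    fromℤ ((sign i Sign.* sign j) ◃ (∣ i ∣ ℕ.* ∣ j ∣))     ≈⟨ fromℤ-◃ (sign i Sign.* sign j) (∣ i ∣ ℕ.* ∣ j ∣) ⟩
    σ (sign i Sign.* sign j) * ((∣ i ∣ ℕ.* ∣ j ∣) × 1#)    ≈⟨ *-cong (σ-* (sign i) (sign j)) (×1-homo-* ∣ i ∣ ∣ j ∣) ⟩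
    (σ (sign i) * σ (sign j)) * (∣ i ∣ × 1# * ∣ j ∣ × 1#)  ≈⟨ *-interchange _ _ _ _ ⟩
    (σ (sign i) * ∣ i ∣ × 1#) * (σ (sign j) * ∣ j ∣ × 1#)  ≈⟨ *-cong (fromℤ≈σ*∣∣ i) (fromℤ≈σ*∣∣ j) ⟨
    fromℤ i * fromℤ j                                      ∎

  homomorphism : CommutativeRing.rawRing ℤ.+-*-commutativeRing -Raw-AlmostCommutative⟶ fromCommutativeRing R
  homomorphism = record
    { ⟦_⟧    = fromℤ
    ; +-homo = fromℤ-+
    ; *-homo = fromℤ-*
    ; -‿homo = fromℤ-neg
    ; 0-homo = refl
    ; 1-homo = refl
    }

  fromℤ-weaklyDecidable : ∀ i j → Maybe (fromℤ i ≈ fromℤ j)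
  fromℤ-weaklyDecidable i j with i ℤ.≟ j
  ... | yes ≡.refl = just refl
  ... | no  _      = nothing

  open Algebra.Solver.Ring _ _ homomorphism fromℤ-weaklyDecidable public using (solve; _:=_; _:+_; _:*_; _:-_; con)

module BinomialShift {c ℓ : Level} (R : CommutativeRing c ℓ) (A B : CommutativeRing.Carrier R) where
  open CommutativeRing R hiding (zero)
  open RingDefs R
  open FiniteSum commutativeSemiring
  open RingLemmas R
  open IntegerCoefficientSolver R using (solve; _:=_; _:+_; _:*_; _:-_; con)
  open import Relation.Binary.Reasoning.Setoid setoid

  term : ℕ → (ℕ → Carrier) → ℕ → Carrier
  term e G l = pow (- 1#) l * fromℕ (e C l) * pow A (e ∸ l) * pow B l * G l

  -- ((A - B E)^e G)(0), where E is the shift G ↦ G ∘ suc.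
  binomialShift : ℕ → (ℕ → Carrier) → Carrier
  binomialShift e G = ∑[ l ≤ e ] term e G l

  term-suc : ∀ e G l → term (suc e) G (suc l) ≈ A * term e G (suc l) - B * term e (λ i → G (suc i)) l
  term-suc e G l = begin
    - 1# * σ * fromℕ (suc e C suc l) * pow A (e ∸ l) * (B * β) * g
      ≈⟨ *-congʳ (*-congʳ (*-congʳ (*-congˡ (trans (reflexive (≡.cong fromℕ (≡.sym (nCk+nC[k+1]≡[n+1]C[k+1] e l)))) (fromℕ-+ (e C l) (e C suc l)))))) ⟩
    - 1# * σ * (c₀ + c₁) * pow A (e ∸ l) * (B * β) * g
      ≈⟨ solve 7 (λ σ c₀ c₁ α B β g → con -[1+ 0 ] :* σ :* (c₀ :+ c₁) :* α :* (B :* β) :* g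
                   := con -[1+ 0 ] :* σ :* B :* β :* g :* (c₁ :* α) :- B :* (σ :* c₀ :* α :* β :* g)) refl σ c₀ c₁ (pow A (e ∸ l)) B β g ⟩
    - 1# * σ * B * β * g * (c₁ * pow A (e ∸ l)) - B * (σ * c₀ * pow A (e ∸ l) * β * g)
      ≈⟨ +-congʳ (*-congˡ c₁*A^[e∸l]≈c₁*[A*A^[e∸l∸1]]) ⟩
    - 1# * σ * B * β * g * (c₁ * (A * pow A (e ∸ suc l))) - B * (σ * c₀ * pow A (e ∸ l) * β * g)
      ≈⟨ +-congʳ (solve 7 (λ σ c₁ α A B β g → con -[1+ 0 ] :* σ :* B :* β :* g :* (c₁ :* (A :* α))
                   := A :* (con -[1+ 0 ] :* σ :* c₁ :* α :* (B :* β) :* g)) refl σ c₁ (pow A (e ∸ suc l)) A B β g) ⟩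
    A * (- 1# * σ * c₁ * pow A (e ∸ suc l) * (B * β) * g) - B * (σ * c₀ * pow A (e ∸ l) * β * g) ∎
    where
    σ = pow (- 1#) l
    β = pow B l
    g = G (suc l)
    c₀ = fromℕ (e C l)
    c₁ = fromℕ (e C suc l)
    c₁*A^[e∸l]≈c₁*[A*A^[e∸l∸1]] : c₁ * pow A (e ∸ l) ≈ c₁ * (A * pow A (e ∸ suc l))
    c₁*A^[e∸l]≈c₁*[A*A^[e∸l∸1]] with l ℕ.<? e
    ... | yes l<e = *-congˡ (reflexive (≡.cong (pow A) (ℕ.+-∸-assoc 1 l<e)))
    ... | no  l≮e = trans (*-congʳ c₁≈0) (trans (zeroˡ _) (sym (trans (*-congʳ c₁≈0) (zeroˡ _))))
      where
      c₁≈0 : c₁ ≈ 0#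
      c₁≈0 = reflexive (≡.cong fromℕ (k>n⇒nCk≡0 (ℕ.s≤s (ℕ.≮⇒≥ l≮e))))

  binomialShift-suc : ∀ e G → A * binomialShift e G - B * binomialShift e (λ i → G (suc i)) ≈ binomialShift (suc e) G
  binomialShift-suc e G = begin
    A * binomialShift e G - B * ∑[ l ≤ e ] term e G′ l
      ≈⟨ +-congʳ (*-congˡ (trans (sym (+-identityʳ _)) (+-congˡ (sym last≈0)))) ⟩
    A * ∑≤ (suc e) (term e G) - B * ∑[ l ≤ e ] term e G′ l
      ≈⟨ +-congʳ (*-congˡ (∑≤-suc e (term e G))) ⟩
    A * (term e G 0 + ∑[ l ≤ e ] term e G (suc l)) - B * ∑[ l ≤ e ] term e G′ l
      ≈⟨ solve 5 (λ A B t₀ x y → A :* (t₀ :+ x) :- B :* y := A :* t₀ :+ (A :* x :- B :* y)) refl A B (term e G 0) _ _ ⟩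
    A * term e G 0 + (A * ∑[ l ≤ e ] term e G (suc l) - B * ∑[ l ≤ e ] term e G′ l)
      ≈⟨ +-cong first (+-cong (*-distribˡ-∑≤ e A _) (-‿cong (*-distribˡ-∑≤ e B _))) ⟩
    term (suc e) G 0 + (∑[ l ≤ e ] (A * term e G (suc l)) - ∑[ l ≤ e ] (B * term e G′ l))
      ≈⟨ +-congˡ (∑≤-distrib-- e _ _) ⟨
    term (suc e) G 0 + ∑[ l ≤ e ] (A * term e G (suc l) - B * term e G′ l)
      ≈⟨ +-congˡ (∑≤-cong e λ l _ → term-suc e G l) ⟨
    term (suc e) G 0 + ∑[ l ≤ e ] term (suc e) G (suc l)
      ≈⟨ ∑≤-suc e (term (suc e) G) ⟨
    binomialShift (suc e) G ∎
    where
    G′ = λ i → G (suc i)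
    last≈0 : term e G (suc e) ≈ 0#
    last≈0 = trans (*-congʳ (*-congʳ (*-congʳ (*-congˡ (reflexive (≡.cong fromℕ (k>n⇒nCk≡0 (ℕ.n<1+n e))))))))
      (solve 4 (λ σ α β g → σ :* con (+ 0) :* α :* β :* g := con (+ 0)) refl _ _ _ _)
    first : A * term e G 0 ≈ term (suc e) G 0
    first = solve 3 (λ A α g → A :* (con (+ 1) :* (con (+ 1) :+ con (+ 0)) :* α :* con (+ 1) :* g)
                     := con (+ 1) :* (con (+ 1) :+ con (+ 0)) :* (A :* α) :* con (+ 1) :* g) refl A (pow A e) (G 0)

module LinearRecurrence {c ℓ : Level} (R : CommutativeRing c ℓ) (p q qi : CommutativeRing.Carrier R)
  (q*qi≈1 : CommutativeRing._≈_ R (CommutativeRing._*_ R q qi) (CommutativeRing.1# R)) where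
  open ℤ-Solver using (solve-∀)
  open CommutativeRing R hiding (zero)
  open RingDefs R
  open FiniteSum commutativeSemiring using (∑≤-cong)
  open IntegerCoefficientSolver R using (solve; _:=_; _:+_; _:*_; _:-_; con)
  open RingProperties ring using (x∙y⁻¹≈ε⇒x≈y; x≈y⇒x∙y⁻¹≈ε)
  open CommutativeSemigroupProperties *-commutativeSemigroup using () renaming (x∙yz≈y∙xz to x*[y*z]≈y*[x*z])
  open import Data.Product using (_×_; _,_)
  open import Relation.Binary.Reasoning.Setoid setoid

  Recurrent : (ℤ → Carrier) → Set ℓ
  Recurrent f = ∀ j → f (j ℤ.+ + 2) ≈ p * f (j ℤ.+ + 1) - q * f j

  ≈-cong : ∀ (f : ℤ → Carrier) {i j} → i ≡ j → f i ≈ f j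
  ≈-cong f i≡j = reflexive (≡.cong f i≡j)

  q*[qi*x]≈x : ∀ x → q * (qi * x) ≈ x
  q*[qi*x]≈x x = trans (sym (*-assoc q qi x)) (trans (*-congʳ q*qi≈1) (*-identityˡ x))

  qi*[q*x]≈x : ∀ x → qi * (q * x) ≈ x
  qi*[q*x]≈x x = trans (x*[y*z]≈y*[x*z] qi q x) (q*[qi*x]≈x x)

  x≈p*y-q*[qi*[p*y-x]] : ∀ x y → x ≈ p * y - q * (qi * (p * y - x))
  x≈p*y-q*[qi*[p*y-x]] x y = trans (solve 3 (λ x y p → x := p :* y :- (p :* y :- x)) refl x y p) (+-congˡ (-‿cong (sym (q*[qi*x]≈x _))))

  W-recurrent : ∀ a b → Recurrent (Horadam.W a b p q qi)
  W-recurrent a b (+ n) rewrite ℕ.+-comm n 2 | ℕ.+-comm n 1 = refl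
  W-recurrent a b -[1+ 0 ]           = x≈p*y-q*[qi*[p*y-x]] b a
  W-recurrent a b -[1+ 1 ]           = x≈p*y-q*[qi*[p*y-x]] a (Horadam.Wneg a b p q qi 1)
  W-recurrent a b -[1+ suc (suc n) ] = x≈p*y-q*[qi*[p*y-x]] (Horadam.Wneg a b p q qi (suc n)) (Horadam.Wneg a b p q qi (suc (suc n)))

  recurrent-shiftʳ : ∀ {f} → Recurrent f → ∀ c → Recurrent (λ j → f (j ℤ.+ c))
  recurrent-shiftʳ {f} f-rec c j = begin
    f (j ℤ.+ + 2 ℤ.+ c)                          ≡⟨ ≡.cong f (swap j (+ 2) c) ⟩
    f (j ℤ.+ c ℤ.+ + 2)                          ≈⟨ f-rec (j ℤ.+ c) ⟩
    p * f (j ℤ.+ c ℤ.+ + 1) - q * f (j ℤ.+ c)    ≡⟨ ≡.cong (λ i → p * f i - q * f (j ℤ.+ c)) (swap j c (+ 1)) ⟩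
    p * f (j ℤ.+ + 1 ℤ.+ c) - q * f (j ℤ.+ c)    ∎
    where
    swap : ∀ i j k → i ℤ.+ j ℤ.+ k ≡ i ℤ.+ k ℤ.+ j
    swap = solve-∀

  recurrent-shiftˡ : ∀ {f} → Recurrent f → ∀ c → Recurrent (λ j → f (c ℤ.+ j))
  recurrent-shiftˡ {f} f-rec c j = begin
    f (c ℤ.+ (j ℤ.+ + 2))                          ≡⟨ ≡.cong f (ℤ.+-assoc c j (+ 2)) ⟨
    f (c ℤ.+ j ℤ.+ + 2)                            ≈⟨ f-rec (c ℤ.+ j) ⟩
    p * f (c ℤ.+ j ℤ.+ + 1) - q * f (c ℤ.+ j)      ≡⟨ ≡.cong (λ i → p * f i - q * f (c ℤ.+ j)) (ℤ.+-assoc c j (+ 1)) ⟩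
    p * f (c ℤ.+ (j ℤ.+ + 1)) - q * f (c ℤ.+ j)    ∎

  recurrent-- : ∀ {f g} → Recurrent f → Recurrent g → Recurrent (λ j → f j - g j)
  recurrent-- f-rec g-rec j = trans (+-cong (f-rec j) (-‿cong (g-rec j)))
    (solve 6 (λ p q a b c d → (p :* a :- q :* b) :- (p :* c :- q :* d) := p :* (a :- c) :- q :* (b :- d)) refl p q _ _ _ _)

  recurrent-*ˡ : ∀ {f} → Recurrent f → ∀ x → Recurrent (λ j → x * f j)
  recurrent-*ˡ f-rec x j = trans (*-congˡ (f-rec j))
    (solve 5 (λ p q x a b → x :* (p :* a :- q :* b) := p :* (x :* a) :- q :* (x :* b)) refl p q x _ _)

  recurrent-*ʳ : ∀ {f} → Recurrent f → ∀ x → Recurrent (λ j → f j * x)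
  recurrent-*ʳ f-rec x j = trans (*-congʳ (f-rec j))
    (solve 5 (λ p q x a b → (p :* a :- q :* b) :* x := p :* (a :* x) :- q :* (b :* x)) refl p q x _ _)

  recurrent-pred : ∀ {f} → Recurrent f → ∀ j → f (j ℤ.+ + 1) ≈ p * f j - q * f (j ℤ.- + 1)
  recurrent-pred {f} f-rec j = begin
    f (j ℤ.+ + 1)                                  ≡⟨ ≡.cong f (index₂ j) ⟩
    f (j ℤ.- + 1 ℤ.+ + 2)                          ≈⟨ f-rec (j ℤ.- + 1) ⟩
    p * f (j ℤ.- + 1 ℤ.+ + 1) - q * f (j ℤ.- + 1)  ≡⟨ ≡.cong (λ i → p * f i - q * f (j ℤ.- + 1)) (index₁ j) ⟩
    p * f j - q * f (j ℤ.- + 1)                    ∎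
    where
    index₂ : ∀ j → j ℤ.+ + 1 ≡ j ℤ.- + 1 ℤ.+ + 2
    index₂ = solve-∀
    index₁ : ∀ j → j ℤ.- + 1 ℤ.+ + 1 ≡ j
    index₁ = solve-∀

  module _ {f : ℤ → Carrier} (f-rec : Recurrent f) where

    recurrent-backward : ∀ j → f (j ℤ.+ + 2) ≈ 0# → f (j ℤ.+ + 1) ≈ 0# → f j ≈ 0#
    recurrent-backward j f[j+2]≈0 f[j+1]≈0 = begin
      f j                                          ≈⟨ qi*[q*x]≈x (f j) ⟨
      qi * (q * f j)                               ≈⟨ *-congˡ (solve 3 (λ p y z → z := p :* y :- (p :* y :- z)) refl p (f (j ℤ.+ + 1)) (q * f j)) ⟩
      qi * (p * f (j ℤ.+ + 1) - (p * f (j ℤ.+ + 1) - q * f j)) ≈⟨ *-congˡ (+-congˡ (-‿cong (f-rec j))) ⟨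
      qi * (p * f (j ℤ.+ + 1) - f (j ℤ.+ + 2))     ≈⟨ *-congˡ (+-cong (*-congˡ f[j+1]≈0) (-‿cong f[j+2]≈0)) ⟩
      qi * (p * 0# - 0#)                           ≈⟨ solve 2 (λ qi p → qi :* (p :* con (+ 0) :- con (+ 0)) := con (+ 0)) refl qi p ⟩
      0#                                           ∎

    module _ (f0≈0 : f (+ 0) ≈ 0#) (f1≈0 : f (+ 1) ≈ 0#) where

      recurrent-forward : ∀ n → f (+ n) ≈ 0# × f (+ suc n) ≈ 0#
      recurrent-forward zero    = f0≈0 , f1≈0
      recurrent-forward (suc n) = f[n+1]≈0 , (begin
        f (+ suc (suc n))                  ≡⟨ ≡.cong (λ k → f (+ k)) (ℕ.+-comm 2 n) ⟩
        f (+ n ℤ.+ + 2)                    ≈⟨ f-rec (+ n) ⟩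
        p * f (+ n ℤ.+ + 1) - q * f (+ n)  ≈⟨ +-cong (*-congˡ (trans (≈-cong f (≡.cong +_ (ℕ.+-comm n 1))) f[n+1]≈0)) (-‿cong (*-congˡ fn≈0)) ⟩
        p * 0# - q * 0#                    ≈⟨ solve 2 (λ p q → p :* con (+ 0) :- q :* con (+ 0) := con (+ 0)) refl p q ⟩
        0#                                 ∎)
        where
        fn≈0 = proj₁ (recurrent-forward n)
        f[n+1]≈0 = proj₂ (recurrent-forward n)

      recurrent-downward : ∀ n → f -[1+ n ] ≈ 0# × f (-[1+ n ] ℤ.+ + 1) ≈ 0#
      recurrent-downward zero    = recurrent-backward -[1+ 0 ] f1≈0 f0≈0 , f0≈0
      recurrent-downward (suc n) = recurrent-backward -[1+ suc n ] f[-n]≈0 f[-1-n]≈0 , f[-1-n]≈0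
        where
        f[-1-n]≈0 = proj₁ (recurrent-downward n)
        f[-n]≈0 = trans (≈-cong f (≡.sym (ℤ.+-assoc -[1+ suc n ] (+ 1) (+ 1)))) (proj₂ (recurrent-downward n))

      recurrent-zero : ∀ j → f j ≈ 0#
      recurrent-zero (+ n)    = proj₁ (recurrent-forward n)
      recurrent-zero -[1+ n ] = proj₁ (recurrent-downward n)

  recurrent-unique : ∀ {f g} → Recurrent f → Recurrent g → f (+ 0) ≈ g (+ 0) → f (+ 1) ≈ g (+ 1) → ∀ j → f j ≈ g j
  recurrent-unique f-rec g-rec f0≈g0 f1≈g1 j =
    x∙y⁻¹≈ε⇒x≈y _ _ (recurrent-zero (recurrent-- f-rec g-rec) (x≈y⇒x∙y⁻¹≈ε f0≈g0) (x≈y⇒x∙y⁻¹≈ε f1≈g1) j)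

  q^_ : ℤ → Carrier
  q^_ = zpow q qi

  q^-suc : ∀ j → q^ (j ℤ.+ + 1) ≈ q * q^ j
  q^-suc (+ n) rewrite ℕ.+-comm n 1 = refl
  q^-suc -[1+ 0 ]     = sym (q*[qi*x]≈x 1#)
  q^-suc -[1+ suc n ] = sym (q*[qi*x]≈x _)

  q^-pred : ∀ j → q^ j ≈ qi * q^ (j ℤ.+ + 1)
  q^-pred j = trans (sym (qi*[q*x]≈x (q^ j))) (*-congˡ (sym (q^-suc j)))

  q^-+ : ∀ i j → q^ (i ℤ.+ j) ≈ q^ i * q^ j
  q^-+ i (+ zero) = trans (≈-cong q^_ (ℤ.+-identityʳ i)) (sym (*-identityʳ _))
  q^-+ i (+ suc n) = begin
    q^ (i ℤ.+ + suc n)           ≡⟨ ≡.cong q^_ (i+[1+n]≡i+n+1 i (+ n)) ⟩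
    q^ (i ℤ.+ + n ℤ.+ + 1)       ≈⟨ q^-suc (i ℤ.+ + n) ⟩
    q * q^ (i ℤ.+ + n)           ≈⟨ *-congˡ (q^-+ i (+ n)) ⟩
    q * (q^ i * pow q n)         ≈⟨ x*[y*z]≈y*[x*z] q (q^ i) (pow q n) ⟩
    q^ i * (q * pow q n)         ∎
    where
    i+[1+n]≡i+n+1 : ∀ i n → i ℤ.+ (+ 1 ℤ.+ n) ≡ i ℤ.+ n ℤ.+ + 1
    i+[1+n]≡i+n+1 = solve-∀
  q^-+ i -[1+ zero ] = begin
    q^ (i ℤ.+ -[1+ 0 ])                 ≈⟨ q^-pred (i ℤ.+ -[1+ 0 ]) ⟩
    qi * q^ (i ℤ.+ -[1+ 0 ] ℤ.+ + 1)    ≡⟨ ≡.cong (λ k → qi * q^ k) (ℤ.+-assoc i -[1+ 0 ] (+ 1)) ⟩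
    qi * q^ (i ℤ.+ + 0)                 ≈⟨ *-congˡ (q^-+ i (+ 0)) ⟩
    qi * (q^ i * 1#)                    ≈⟨ x*[y*z]≈y*[x*z] qi (q^ i) 1# ⟩
    q^ i * (qi * 1#)                    ∎
  q^-+ i -[1+ suc n ] = begin
    q^ (i ℤ.+ -[1+ suc n ])                 ≈⟨ q^-pred (i ℤ.+ -[1+ suc n ]) ⟩
    qi * q^ (i ℤ.+ -[1+ suc n ] ℤ.+ + 1)    ≡⟨ ≡.cong (λ k → qi * q^ k) (ℤ.+-assoc i -[1+ suc n ] (+ 1)) ⟩
    qi * q^ (i ℤ.+ -[1+ n ])                ≈⟨ *-congˡ (q^-+ i -[1+ n ]) ⟩
    qi * (q^ i * pow qi (suc n))            ≈⟨ x*[y*z]≈y*[x*z] qi (q^ i) (pow qi (suc n)) ⟩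
    q^ i * (qi * pow qi (suc n))            ∎

  module HoradamSequences (a b : Carrier) where
    W U : ℤ → Carrier
    W = Horadam.W a b p q qi
    U = Horadam.W 0# 1# p q qi

    q^s*W[T-s]-recurrent : ∀ T → Recurrent (λ s → q^ s * W (T ℤ.- s))
    q^s*W[T-s]-recurrent T s = begin
      q^ (s ℤ.+ + 2) * w₂                         ≈⟨ *-congʳ (trans (≈-cong q^_ (≡.sym (ℤ.+-assoc s (+ 1) (+ 1)))) (q^-suc (s ℤ.+ + 1))) ⟩
      q * z₁ * w₂
        ≈⟨ solve 5 (λ p q z₁ w₁ w₂ → q :* z₁ :* w₂ := p :* (z₁ :* w₁) :- z₁ :* (p :* w₁ :- q :* w₂)) refl p q z₁ w₁ w₂ ⟩
      p * (z₁ * w₁) - z₁ * (p * w₁ - q * w₂)      ≈⟨ +-congˡ (-‿cong (*-cong (q^-suc s) (sym W[T-s]-unfold))) ⟩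
      p * (z₁ * w₁) - q * q^ s * W (T ℤ.- s)      ≈⟨ +-congˡ (-‿cong (*-assoc q (q^ s) (W (T ℤ.- s)))) ⟩
      p * (z₁ * w₁) - q * (q^ s * W (T ℤ.- s))    ∎
      where
      z₁ = q^ (s ℤ.+ + 1)
      w₁ = W (T ℤ.- (s ℤ.+ + 1))
      w₂ = W (T ℤ.- (s ℤ.+ + 2))
      W[T-s]-unfold : W (T ℤ.- s) ≈ p * w₁ - q * w₂
      W[T-s]-unfold = begin
        W (T ℤ.- s)                                           ≡⟨ ≡.cong W (index₀ T s) ⟩
        W (T ℤ.- (s ℤ.+ + 1) ℤ.+ + 1)                         ≈⟨ recurrent-pred (W-recurrent a b) (T ℤ.- (s ℤ.+ + 1)) ⟩
        p * w₁ - q * W (T ℤ.- (s ℤ.+ + 1) ℤ.- + 1)            ≡⟨ ≡.cong (λ i → p * w₁ - q * W i) (index₂ T s) ⟩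
        p * w₁ - q * w₂                                       ∎
        where
        index₀ : ∀ T s → T ℤ.- s ≡ T ℤ.- (s ℤ.+ + 1) ℤ.+ + 1
        index₀ = solve-∀
        index₂ : ∀ T s → T ℤ.- (s ℤ.+ + 1) ℤ.- + 1 ≡ T ℤ.- (s ℤ.+ + 2)
        index₂ = solve-∀

    q^s*W[T-s]≈U[s+1]*WT-Us*W[T+1] : ∀ T s → q^ s * W (T ℤ.- s) ≈ U (s ℤ.+ + 1) * W T - U s * W (T ℤ.+ + 1)
    q^s*W[T-s]≈U[s+1]*WT-Us*W[T+1] T = recurrent-unique (q^s*W[T-s]-recurrent T)
      (recurrent-- (recurrent-*ʳ (recurrent-shiftʳ (W-recurrent 0# 1#) (+ 1)) (W T)) (recurrent-*ʳ (W-recurrent 0# 1#) (W (T ℤ.+ + 1))))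
      (begin
        1# * W (T ℤ.- + 0)                         ≡⟨ ≡.cong (λ i → 1# * W i) (ℤ.+-identityʳ T) ⟩
        1# * W T                                   ≈⟨ solve 2 (λ x y → con (+ 1) :* x := con (+ 1) :* x :- con (+ 0) :* y) refl (W T) (W (T ℤ.+ + 1)) ⟩
        1# * W T - 0# * W (T ℤ.+ + 1)              ∎)
      (begin
        q * 1# * W (T ℤ.- + 1)
          ≈⟨ solve 4 (λ p q x y → q :* con (+ 1) :* x := (p :* con (+ 1) :- q :* con (+ 0)) :* y :- con (+ 1) :* (p :* y :- q :* x))
               refl p q (W (T ℤ.- + 1)) (W T) ⟩
        U (+ 2) * W T - 1# * (p * W T - q * W (T ℤ.- + 1)) ≈⟨ +-congˡ (-‿cong (*-congˡ (recurrent-pred (W-recurrent a b) T))) ⟨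
        U (+ 2) * W T - 1# * W (T ℤ.+ + 1)         ∎)

    q^s*Ur*W[T-s]≈U[r+s]*WT-Us*W[T+r] : ∀ T r s → q^ s * U r * W (T ℤ.- s) ≈ U (r ℤ.+ s) * W T - U s * W (T ℤ.+ r)
    q^s*Ur*W[T-s]≈U[r+s]*WT-Us*W[T+r] T r s = recurrent-unique
      (recurrent-*ʳ (recurrent-*ˡ (W-recurrent 0# 1#) (q^ s)) (W (T ℤ.- s)))
      (recurrent-- (recurrent-*ʳ (recurrent-shiftʳ (W-recurrent 0# 1#) s) (W T)) (recurrent-*ˡ (recurrent-shiftˡ (W-recurrent a b) T) (U s)))
      (begin
        q^ s * 0# * W (T ℤ.- s)                    ≈⟨ solve 3 (λ z x y → z :* con (+ 0) :* x := y :- y) refl (q^ s) (W (T ℤ.- s)) (U s * W T) ⟩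
        U s * W T - U s * W T                      ≡⟨ ≡.cong₂ (λ i j → U i * W T - U s * W j) (ℤ.+-identityˡ s) (ℤ.+-identityʳ T) ⟨
        U (+ 0 ℤ.+ s) * W T - U s * W (T ℤ.+ + 0)  ∎)
      (begin
        q^ s * 1# * W (T ℤ.- s)                    ≈⟨ *-congʳ (*-identityʳ (q^ s)) ⟩
        q^ s * W (T ℤ.- s)                         ≈⟨ q^s*W[T-s]≈U[s+1]*WT-Us*W[T+1] T s ⟩
        U (s ℤ.+ + 1) * W T - U s * W (T ℤ.+ + 1)  ≡⟨ ≡.cong (λ i → U i * W T - U s * W (T ℤ.+ + 1)) (ℤ.+-comm (+ 1) s) ⟨
        U (+ 1 ℤ.+ s) * W T - U s * W (T ℤ.+ + 1)  ∎)
      r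

    module Expansion (r s : ℤ) where
      open BinomialShift R (U (r ℤ.+ s)) (U s) using (binomialShift; binomialShift-suc)

      q^[se]*Ur^e*W[T-se]≈binomialShift : ∀ e T →
        q^ (s ℤ.* + e) * pow (U r) e * W (T ℤ.- s ℤ.* + e) ≈ binomialShift e (λ l → W (T ℤ.+ r ℤ.* + l))
      q^[se]*Ur^e*W[T-se]≈binomialShift zero T = begin
        q^ (s ℤ.* + 0) * 1# * W (T ℤ.- s ℤ.* + 0)      ≡⟨ ≡.cong₂ (λ i j → q^ i * 1# * W j) (ℤ.*-zeroʳ s) (T-s*0≡T T s) ⟩
        1# * 1# * W T
          ≈⟨ solve 1 (λ w → con (+ 1) :* con (+ 1) :* w := con (+ 1) :* (con (+ 1) :+ con (+ 0)) :* con (+ 1) :* con (+ 1) :* w) refl (W T) ⟩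
        1# * (1# + 0#) * 1# * 1# * W T                 ≡⟨ ≡.cong (λ i → 1# * (1# + 0#) * 1# * 1# * W i) (T+r*0≡T T r) ⟨
        1# * (1# + 0#) * 1# * 1# * W (T ℤ.+ r ℤ.* + 0) ∎
        where
        T-s*0≡T : ∀ T s → T ℤ.- s ℤ.* + 0 ≡ T
        T-s*0≡T = solve-∀
        T+r*0≡T : ∀ T r → T ℤ.+ r ℤ.* + 0 ≡ T
        T+r*0≡T = solve-∀
      q^[se]*Ur^e*W[T-se]≈binomialShift (suc e) T = begin
        q^ (s ℤ.* + suc e) * (U r * pow (U r) e) * W (T ℤ.- s ℤ.* + suc e)
          ≈⟨ *-cong (*-congʳ (trans (≈-cong q^_ (index₁ s (+ e))) (q^-+ (s ℤ.* + e) s))) (≈-cong W (index₂ T s (+ e))) ⟩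
        q^ (s ℤ.* + e) * q^ s * (U r * pow (U r) e) * W (T′ ℤ.- s)
          ≈⟨ solve 5 (λ z₁ z₂ u v w → z₁ :* z₂ :* (u :* v) :* w := z₁ :* v :* (z₂ :* u :* w)) refl
               (q^ (s ℤ.* + e)) (q^ s) (U r) (pow (U r) e) (W (T′ ℤ.- s)) ⟩
        q^ (s ℤ.* + e) * pow (U r) e * (q^ s * U r * W (T′ ℤ.- s))
          ≈⟨ *-congˡ (q^s*Ur*W[T-s]≈U[r+s]*WT-Us*W[T+r] T′ r s) ⟩
        q^ (s ℤ.* + e) * pow (U r) e * (U (r ℤ.+ s) * W T′ - U s * W (T′ ℤ.+ r))
          ≈⟨ solve 5 (λ x A B w₁ w₂ → x :* (A :* w₁ :- B :* w₂) := A :* (x :* w₁) :- B :* (x :* w₂)) refl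
               (q^ (s ℤ.* + e) * pow (U r) e) (U (r ℤ.+ s)) (U s) (W T′) (W (T′ ℤ.+ r)) ⟩
        U (r ℤ.+ s) * (q^ (s ℤ.* + e) * pow (U r) e * W T′) - U s * (q^ (s ℤ.* + e) * pow (U r) e * W (T′ ℤ.+ r))
          ≈⟨ +-cong (*-congˡ (q^[se]*Ur^e*W[T-se]≈binomialShift e T)) (-‿cong (*-congˡ (trans
               (*-congˡ (≈-cong W (index₃ T s (+ e) r))) (q^[se]*Ur^e*W[T-se]≈binomialShift e (T ℤ.+ r))))) ⟩
        U (r ℤ.+ s) * binomialShift e G - U s * binomialShift e (λ l → W (T ℤ.+ r ℤ.+ r ℤ.* + l))
          ≈⟨ +-congˡ (-‿cong (*-congˡ (∑≤-cong e λ l _ → *-congˡ (≈-cong W (index₄ T r (+ l)))))) ⟩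
        U (r ℤ.+ s) * binomialShift e G - U s * binomialShift e (λ l → G (suc l))
          ≈⟨ binomialShift-suc e G ⟩
        binomialShift (suc e) G ∎
        where
        T′ = T ℤ.- s ℤ.* + e
        G = λ l → W (T ℤ.+ r ℤ.* + l)
        index₁ : ∀ s e → s ℤ.* (+ 1 ℤ.+ e) ≡ s ℤ.* e ℤ.+ s
        index₁ = solve-∀
        index₂ : ∀ T s e → T ℤ.- s ℤ.* (+ 1 ℤ.+ e) ≡ T ℤ.- s ℤ.* e ℤ.- s
        index₂ = solve-∀
        index₃ : ∀ T s e r → T ℤ.- s ℤ.* e ℤ.+ r ≡ T ℤ.+ r ℤ.- s ℤ.* e
        index₃ = solve-∀
        index₄ : ∀ T r l → T ℤ.+ r ℤ.+ r ℤ.* l ≡ T ℤ.+ r ℤ.* (+ 1 ℤ.+ l)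
        index₄ = solve-∀

module CubeIdentity {c ℓ : Level} (R : CommutativeRing c ℓ) (p q qi : CommutativeRing.Carrier R)
  (q*qi≈1 : CommutativeRing._≈_ R (CommutativeRing._*_ R q qi) (CommutativeRing.1# R))
  (a b : CommutativeRing.Carrier R) (n : ℕ) (r s t : ℤ) where
  open ℤ-Solver using (solve-∀)
  open CommutativeRing R hiding (zero)
  open RingDefs R
  open FiniteSum commutativeSemiring
  open Binomial using (nCm³≡∑nCm*mCk*[n∸m]Ck*[n+k]Ck; nC[k+l]*[k+l]Ck*[n∸[k+l]]Ck*[n+k]Ck≡[n+k]C2k*2kCk*[n∸k]Ck*[n∸2k]Cl)
  open RingLemmas R
  open IntegerCoefficientSolver R using (solve; _:=_; _:+_; _:*_; _:-_; con)
  open LinearRecurrence R p q qi q*qi≈1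
  open HoradamSequences a b
  open Expansion r s
  open BinomialShift R (U (r ℤ.+ s)) (U s) using (term; binomialShift)
  open import Relation.Binary.Reasoning.Setoid setoid

  A B : Carrier
  A = U (r ℤ.+ s)
  B = U s

  g : ℕ → Carrier
  g m = pow (- 1#) m * pow A (n ∸ m) * pow B m * W (t ℤ.+ r ℤ.* + m)

  coefficient : ℕ → ℕ → ℕ
  coefficient k m = (n C m) ℕ.* (m C k) ℕ.* ((n ∸ m) C k) ℕ.* ((n ℕ.+ k) C k)

  ∑coefficient : ∀ m → m ≤ n → fromℕ ((n C m) ℕ.* ((n C m) ℕ.* (n C m))) ≈ ∑[ k ≤ n ] fromℕ (coefficient k m)
  ∑coefficient m m≤n = trans (reflexive (≡.cong fromℕ (nCm³≡∑nCm*mCk*[n∸m]Ck*[n+k]Ck m≤n))) (fromℕ-∑≤ n (λ k → coefficient k m))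

  LHS RHS : ℕ → Carrier
  LHS k = pow (- 1#) k * pow (fromℕ (n C k)) 3 * pow (U (r ℤ.+ s)) (n ∸ k) * pow (U s) k * W (t ℤ.+ r ℤ.* + k)
  RHS k = pow (- 1#) k * fromℕ ((ℕ._+_ n k) C (ℕ._*_ 2 k)) * fromℕ ((ℕ._*_ 2 k) C k) * fromℕ ((n ∸ k) C k) * zpow q qi (s ℤ.* (+ n ℤ.- + (ℕ._*_ 2 k))) * pow (U (r ℤ.+ s)) k * pow (U s) k * pow (U r) (n ∸ ℕ._*_ 2 k) * W (t ℤ.+ r ℤ.* + k ℤ.- s ℤ.* (+ n ℤ.- + (ℕ._*_ 2 k)))

  LHS≈nCm³*g : ∀ m → LHS m ≈ fromℕ ((n C m) ℕ.* ((n C m) ℕ.* (n C m))) * g m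
  LHS≈nCm³*g m = begin
    LHS m
      ≈⟨ solve 5 (λ σ c α β w → σ :* (c :* (c :* (c :* con (+ 1)))) :* α :* β :* w := c :* (c :* c) :* (σ :* α :* β :* w)) refl
           (pow (- 1#) m) (fromℕ (n C m)) (pow A (n ∸ m)) (pow B m) (W (t ℤ.+ r ℤ.* + m)) ⟩
    fromℕ (n C m) * (fromℕ (n C m) * fromℕ (n C m)) * g m
      ≈⟨ *-congʳ (trans (fromℕ-* (n C m) _) (*-congˡ (fromℕ-* (n C m) (n C m)))) ⟨
    fromℕ ((n C m) ℕ.* ((n C m) ℕ.* (n C m))) * g m ∎

  module Column (k : ℕ) (k≤n : k ≤ n) where
    e : ℕ
    e = n ∸ 2 ℕ.* k

    κ : ℕ
    κ = ((n ℕ.+ k) C (2 ℕ.* k)) ℕ.* ((2 ℕ.* k) C k) ℕ.* ((n ∸ k) C k)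

    T : ℤ
    T = t ℤ.+ r ℤ.* + k

    G : ℕ → Carrier
    G l = W (T ℤ.+ r ℤ.* + l)

    K : Carrier
    K = pow (- 1#) k * fromℕ κ * pow A k * pow B k

    column-shift : ∑[ m ≤ n ] (fromℕ (coefficient k m) * g m) ≈ ∑[ l ≤ n ∸ k ] (fromℕ (κ ℕ.* (e C l)) * g (k ℕ.+ l))
    column-shift = begin
      ∑[ m ≤ n ] (fromℕ (coefficient k m) * g m)
        ≡⟨ ≡.cong (λ N → ∑[ m ≤ N ] (fromℕ (coefficient k m) * g m)) (ℕ.m+[n∸m]≡n k≤n) ⟨
      ∑[ m ≤ k ℕ.+ (n ∸ k) ] (fromℕ (coefficient k m) * g m)
        ≈⟨ ∑≤-shift k (n ∸ k) _ (λ m m<k → trans (*-congʳ (reflexive (≡.cong fromℕ (coefficient≡0 m m<k)))) (zeroˡ (g m))) ⟩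
      ∑[ l ≤ n ∸ k ] (fromℕ (coefficient k (k ℕ.+ l)) * g (k ℕ.+ l))
        ≈⟨ ∑≤-cong (n ∸ k) (λ l _ → *-congʳ (reflexive (≡.cong fromℕ (nC[k+l]*[k+l]Ck*[n∸[k+l]]Ck*[n+k]Ck≡[n+k]C2k*2kCk*[n∸k]Ck*[n∸2k]Cl n k l)))) ⟩
      ∑[ l ≤ n ∸ k ] (fromℕ (κ ℕ.* (e C l)) * g (k ℕ.+ l)) ∎
      where
      coefficient≡0 : ∀ m → m < k → coefficient k m ≡ 0
      coefficient≡0 m m<k = ≡.trans (≡.cong (λ x → (n C m) ℕ.* x ℕ.* ((n ∸ m) C k) ℕ.* ((n ℕ.+ k) C k)) (k>n⇒nCk≡0 m<k))
        (x*0*y*z≡0 (n C m) ((n ∸ m) C k) ((n ℕ.+ k) C k))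
        where
        x*0*y*z≡0 : ∀ x y z → x ℕ.* 0 ℕ.* y ℕ.* z ≡ 0
        x*0*y*z≡0 = ℕ-Solver.solve-∀

    column≈RHS-degenerate : n < 2 ℕ.* k → ∑[ m ≤ n ] (fromℕ (coefficient k m) * g m) ≈ RHS k
    column≈RHS-degenerate n<2k = begin
      ∑[ m ≤ n ] (fromℕ (coefficient k m) * g m)              ≈⟨ column-shift ⟩
      ∑[ l ≤ n ∸ k ] (fromℕ (κ ℕ.* (e C l)) * g (k ℕ.+ l))    ≈⟨ ∑≤-zero (n ∸ k) (λ l _ → trans (*-congʳ (reflexive (≡.cong fromℕ (κ*x≡0 (e C l))))) (zeroˡ _)) ⟩
      0#                                                      ≈⟨ RHS≈0 ⟨
      RHS k                                                   ∎
      where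
      [n∸k]Ck≡0 : (n ∸ k) C k ≡ 0
      [n∸k]Ck≡0 = k>n⇒nCk≡0 (ℕ.+-cancelˡ-< k (n ∸ k) k (≡.subst (ℕ._< k ℕ.+ k) (≡.sym (ℕ.m+[n∸m]≡n k≤n))
                    (≡.subst (n ℕ.<_) (≡.cong (k ℕ.+_) (ℕ.+-identityʳ k)) n<2k)))
      κ*x≡0 : ∀ x → κ ℕ.* x ≡ 0
      κ*x≡0 x = ≡.trans (≡.cong (λ y → ((n ℕ.+ k) C (2 ℕ.* k)) ℕ.* ((2 ℕ.* k) C k) ℕ.* y ℕ.* x) [n∸k]Ck≡0)
        (x*y*0*z≡0 ((n ℕ.+ k) C (2 ℕ.* k)) ((2 ℕ.* k) C k) x)
        where
        x*y*0*z≡0 : ∀ x y z → x ℕ.* y ℕ.* 0 ℕ.* z ≡ 0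
        x*y*0*z≡0 = ℕ-Solver.solve-∀
      RHS≈0 : RHS k ≈ 0#
      RHS≈0 = trans (*-congʳ (*-congʳ (*-congʳ (*-congʳ (*-congʳ (*-congˡ (reflexive (≡.cong fromℕ [n∸k]Ck≡0))))))))
        (solve 8 (λ x₁ x₂ x₃ x₅ x₆ x₇ x₈ x₉ → x₁ :* x₂ :* x₃ :* con (+ 0) :* x₅ :* x₆ :* x₇ :* x₈ :* x₉ := con (+ 0)) refl _ _ _ _ _ _ _ _)

    module _ (2k≤n : 2 ℕ.* k ≤ n) where

      column-term : ∀ l → l ≤ e → fromℕ (κ ℕ.* (e C l)) * g (k ℕ.+ l) ≈ K * term e G l
      column-term l l≤e = begin
        fromℕ (κ ℕ.* (e C l)) * g (k ℕ.+ l)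
          ≈⟨ *-cong (fromℕ-* κ (e C l)) g[k+l]-split ⟩
        fromℕ κ * fromℕ (e C l) * (pow (- 1#) k * pow (- 1#) l * (pow A k * pow A (e ∸ l)) * (pow B k * pow B l) * G l)
          ≈⟨ solve 9 (λ κ c σₖ σₗ αₖ αₗ βₖ βₗ w → κ :* c :* (σₖ :* σₗ :* (αₖ :* αₗ) :* (βₖ :* βₗ) :* w)
                       := σₖ :* κ :* αₖ :* βₖ :* (σₗ :* c :* αₗ :* βₗ :* w)) refl
               (fromℕ κ) (fromℕ (e C l)) (pow (- 1#) k) (pow (- 1#) l) (pow A k) (pow A (e ∸ l)) (pow B k) (pow B l) (G l) ⟩
        K * term e G l ∎
        where
        rearrange : ∀ k l d → 2 ℕ.* k ℕ.+ (l ℕ.+ d) ≡ k ℕ.+ l ℕ.+ (k ℕ.+ d)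
        rearrange = ℕ-Solver.solve-∀
        n≡[k+l]+[k+[e∸l]] : n ≡ k ℕ.+ l ℕ.+ (k ℕ.+ (e ∸ l))
        n≡[k+l]+[k+[e∸l]] = ≡.trans (≡.sym (ℕ.m+[n∸m]≡n 2k≤n)) (≡.trans (≡.cong (2 ℕ.* k ℕ.+_) (≡.sym (ℕ.m+[n∸m]≡n l≤e))) (rearrange k l (e ∸ l)))
        n∸[k+l]≡k+[e∸l] : n ∸ (k ℕ.+ l) ≡ k ℕ.+ (e ∸ l)
        n∸[k+l]≡k+[e∸l] = ≡.trans (≡.cong (_∸ (k ℕ.+ l)) n≡[k+l]+[k+[e∸l]]) (ℕ.m+n∸m≡n (k ℕ.+ l) (k ℕ.+ (e ∸ l)))
        t+r[k+l]≡t+rk+rl : ∀ t r k l → t ℤ.+ r ℤ.* (k ℤ.+ l) ≡ t ℤ.+ r ℤ.* k ℤ.+ r ℤ.* l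
        t+r[k+l]≡t+rk+rl = solve-∀
        t+r[k+l]≡T+rl : t ℤ.+ r ℤ.* + (k ℕ.+ l) ≡ T ℤ.+ r ℤ.* + l
        t+r[k+l]≡T+rl = ≡.trans (≡.cong (λ i → t ℤ.+ r ℤ.* i) (ℤ.pos-+ k l)) (t+r[k+l]≡t+rk+rl t r (+ k) (+ l))
        A^[n∸[k+l]]-split : pow A (n ∸ (k ℕ.+ l)) ≈ pow A k * pow A (e ∸ l)
        A^[n∸[k+l]]-split = trans (reflexive (≡.cong (pow A) n∸[k+l]≡k+[e∸l])) (pow-+ A k (e ∸ l))
        g[k+l]-split : g (k ℕ.+ l) ≈ pow (- 1#) k * pow (- 1#) l * (pow A k * pow A (e ∸ l)) * (pow B k * pow B l) * G l
        g[k+l]-split = *-cong (*-cong (*-cong (pow-+ (- 1#) k l) A^[n∸[k+l]]-split) (pow-+ B k l)) (≈-cong W t+r[k+l]≡T+rl)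

      RHS≈K*q^[se]*Ur^e*W[T-se] : RHS k ≈ K * (q^ (s ℤ.* + e) * pow (U r) e * W (T ℤ.- s ℤ.* + e))
      RHS≈K*q^[se]*Ur^e*W[T-se] = begin
        σ * f₁ * f₂ * f₃ * q^ (s ℤ.* (+ n ℤ.- + (2 ℕ.* k))) * pow A k * pow B k * pow (U r) e * W (T ℤ.- s ℤ.* (+ n ℤ.- + (2 ℕ.* k)))
          ≡⟨ ≡.cong (λ i → σ * f₁ * f₂ * f₃ * q^ (s ℤ.* i) * pow A k * pow B k * pow (U r) e * W (T ℤ.- s ℤ.* i)) n-2k≡e ⟩
        σ * f₁ * f₂ * f₃ * q^ (s ℤ.* + e) * pow A k * pow B k * pow (U r) e * W (T ℤ.- s ℤ.* + e)
          ≈⟨ solve 9 (λ σ f₁ f₂ f₃ z α β u w → σ :* f₁ :* f₂ :* f₃ :* z :* α :* β :* u :* w := σ :* (f₁ :* f₂ :* f₃) :* α :* β :* (z :* u :* w)) refl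
               σ f₁ f₂ f₃ (q^ (s ℤ.* + e)) (pow A k) (pow B k) (pow (U r) e) (W (T ℤ.- s ℤ.* + e)) ⟩
        σ * (f₁ * f₂ * f₃) * pow A k * pow B k * (q^ (s ℤ.* + e) * pow (U r) e * W (T ℤ.- s ℤ.* + e))
          ≈⟨ *-congʳ (*-congʳ (*-congʳ (*-congˡ (trans (fromℕ-* (X₁ ℕ.* X₂) X₃) (*-congʳ (fromℕ-* X₁ X₂)))))) ⟨
        K * (q^ (s ℤ.* + e) * pow (U r) e * W (T ℤ.- s ℤ.* + e)) ∎
        where
        X₁ = (n ℕ.+ k) C (2 ℕ.* k)
        X₂ = (2 ℕ.* k) C k
        X₃ = (n ∸ k) C k
        σ = pow (- 1#) k
        f₁ = fromℕ X₁
        f₂ = fromℕ X₂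
        f₃ = fromℕ X₃
        n-2k≡e : + n ℤ.- + (2 ℕ.* k) ≡ + e
        n-2k≡e = ≡.trans (ℤ.m-n≡m⊖n n (2 ℕ.* k)) (ℤ.⊖-≥ 2k≤n)

      column≈RHS-regular : ∑[ m ≤ n ] (fromℕ (coefficient k m) * g m) ≈ RHS k
      column≈RHS-regular = begin
        ∑[ m ≤ n ] (fromℕ (coefficient k m) * g m)               ≈⟨ column-shift ⟩
        ∑[ l ≤ n ∸ k ] (fromℕ (κ ℕ.* (e C l)) * g (k ℕ.+ l))     ≈⟨ ∑≤-truncate _ e≤n∸k (λ l e<l → trans (*-congʳ (reflexive (≡.cong fromℕ (κ*eCl≡0 l e<l)))) (zeroˡ _)) ⟩
        ∑[ l ≤ e ] (fromℕ (κ ℕ.* (e C l)) * g (k ℕ.+ l))         ≈⟨ ∑≤-cong e column-term ⟩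
        ∑[ l ≤ e ] (K * term e G l)                              ≈⟨ *-distribˡ-∑≤ e K _ ⟨
        K * binomialShift e G                                    ≈⟨ *-congˡ (q^[se]*Ur^e*W[T-se]≈binomialShift e T) ⟨
        K * (q^ (s ℤ.* + e) * pow (U r) e * W (T ℤ.- s ℤ.* + e))  ≈⟨ RHS≈K*q^[se]*Ur^e*W[T-se] ⟨
        RHS k                                                    ∎
        where
        e≤n∸k : e ≤ n ∸ k
        e≤n∸k = ℕ.∸-monoʳ-≤ n (ℕ.m≤m+n k (k ℕ.+ 0))
        κ*eCl≡0 : ∀ l → e < l → κ ℕ.* (e C l) ≡ 0
        κ*eCl≡0 l e<l = ≡.trans (≡.cong (κ ℕ.*_) (k>n⇒nCk≡0 e<l)) (ℕ.*-zeroʳ κ)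

    column≈RHS : ∑[ m ≤ n ] (fromℕ (coefficient k m) * g m) ≈ RHS k
    column≈RHS with 2 ℕ.* k ℕ.≤? n
    ... | yes 2k≤n = column≈RHS-regular 2k≤n
    ... | no  2k≰n = column≈RHS-degenerate (ℕ.≰⇒> 2k≰n)

  cube-identity : sumTo n LHS ≈ sumTo n RHS
  cube-identity = begin
    sumTo n LHS                                                ≡⟨ sumTo≡∑≤ n LHS ⟩
    ∑[ m ≤ n ] LHS m                                           ≈⟨ ∑≤-cong n (λ m m≤n → trans (LHS≈nCm³*g m) (*-congʳ (∑coefficient m m≤n))) ⟩
    ∑[ m ≤ n ] ((∑[ k ≤ n ] fromℕ (coefficient k m)) * g m)    ≈⟨ ∑≤-cong n (λ m _ → *-distribʳ-∑≤ n (g m) _) ⟩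
    ∑[ m ≤ n ] ∑[ k ≤ n ] (fromℕ (coefficient k m) * g m)      ≈⟨ ∑≤-comm n n _ ⟩
    ∑[ k ≤ n ] ∑[ m ≤ n ] (fromℕ (coefficient k m) * g m)      ≈⟨ ∑≤-cong n Column.column≈RHS ⟩
    ∑[ k ≤ n ] RHS k                                           ≡⟨ sumTo≡∑≤ n RHS ⟨
    sumTo n RHS                                                ∎

theorem61 : {c ℓ : Level} (R : CommutativeRing c ℓ) (F : IsField R) →
    let open CommutativeRing R in
    let open RingDefs R in
    (a b p q : Carrier) → ¬ (p ≈ 0#) → (q≉0 : ¬ (q ≈ 0#)) →
    let qi = proj₁ (IsField.inverse F q q≉0) in
    let W = Horadam.W a b p q qi in
    let U = Horadam.W 0# 1# p q qi in
    (n : ℕ) (r s t : ℤ) →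
    sumTo n (λ k → pow (- 1#) k * pow (fromℕ (n C k)) 3 * pow (U (r ℤ.+ s)) (n ∸ k) * pow (U s) k * W (t ℤ.+ r ℤ.* + k))
      ≈ sumTo n (λ k → pow (- 1#) k * fromℕ ((ℕ._+_ n k) C (ℕ._*_ 2 k)) * fromℕ ((ℕ._*_ 2 k) C k) * fromℕ ((n ∸ k) C k) * zpow q qi (s ℤ.* (+ n ℤ.- + (ℕ._*_ 2 k))) * pow (U (r ℤ.+ s)) k * pow (U s) k * pow (U r) (n ∸ ℕ._*_ 2 k) * W (t ℤ.+ r ℤ.* + k ℤ.- s ℤ.* (+ n ℤ.- + (ℕ._*_ 2 k))))
theorem61 R F a b p q _ q≉0 n r s t = CubeIdentity.cube-identity R p q (proj₁ inverse) (proj₂ inverse) a b n r s t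
  where inverse = IsField.inverse F q q≉0
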